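{- For every integer $r\ge 0$, the generating function $\sum_{n\ge0} a_{n,r}x^n$, where $a_{n,r}$ is the number of words $\sigma\in[2]^n$ containing the subword pattern $112$ exactly $r$ times, equals \[ \frac{x^{3r}}{(1-x)^{r+1}(1-x-x^2)^{r+1}}. \]
   Context: $[2]^n$ is the set of words of length $n$ over $\{1,2\}$. An occurrence of the subword pattern $112$ in a word $\sigma=\sigma_1\cdots\sigma_n$ is an index $i$ with $\sigma_i=\sigma_{i+1}<\sigma_{i+2}$ (three consecutive letters). "Containing exactly $r$ times" means having exactly $r$ such occurrences. -}

module Defs where

open import Data.Nat as ℕ using (ℕ; zero; suc; _∸_)
open import Data.Integer as ℤ using (ℤ; +_; -_)
open import Data.Fin using (Fin; zero; suc; _<?_)
open import Data.Fin.Properties using () renaming (_≟_ to _≟F_)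
open import Data.Vec using (Vec; []; _∷_)
open import Data.List using (List; []; _∷_; map; concatMap; upTo; length; filter)
open import Relation.Nullary using (yes; no)
open import Relation.Binary.PropositionalEquality using (_≡_)

-- Words over [2] = {1,2}; letter 1 is represented by zero, 2 by suc zero.

Word : ℕ → Set
Word n = Vec (Fin 2) n

allWords : (n : ℕ) → List (Word n)
allWords zero    = [] ∷ []
allWords (suc n) = concatMap (λ w → (zero ∷ w) ∷ (suc zero ∷ w) ∷ []) (allWords n)

occ112 : ∀ {n} → Word n → ℕ
occ112 (a ∷ rest@(b ∷ c ∷ _)) = is112 a b c ℕ.+ occ112 rest
  where
  is112 : Fin 2 → Fin 2 → Fin 2 → ℕ
  is112 a b c with a ≟F b | b <? c
  ... | yes _ | yes _ = 1
  ... | _     | _     = 0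
occ112 _ = 0

a : ℕ → ℕ → ℕ
a n r = length (filter (λ w → occ112 w ℕ.≟ r) (allWords n))

FPS : Set
FPS = ℕ → ℤ

sumℤ : List ℤ → ℤ
sumℤ []       = + 0
sumℤ (z ∷ zs) = z ℤ.+ sumℤ zs

_⊛_ : FPS → FPS → FPS
(f ⊛ g) n = sumℤ (map (λ k → f k ℤ.* g (n ∸ k)) (upTo (suc n)))

infixl 7 _⊛_

oneS : FPS
oneS zero    = + 1
oneS (suc _) = + 0

X : FPS
X 1 = + 1
X _ = + 0

_^S_ : FPS → ℕ → FPS
f ^S zero  = oneS
f ^S suc k = f ⊛ (f ^S k)

oneMinusX : FPS
oneMinusX 0 = + 1
oneMinusX 1 = - (+ 1)
oneMinusX _ = + 0

oneMinusXMinusX² : FPS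
oneMinusXMinusX² 0 = + 1
oneMinusXMinusX² 1 = - (+ 1)
oneMinusXMinusX² 2 = - (+ 1)
oneMinusXMinusX² _ = + 0

genFun : ℕ → FPS
genFun r n = + (a n r)

{-# OPTIONS --safe #-}
module Submission where

open import Defs
open import Data.Nat using (ℕ; suc; _*_)
open import Relation.Binary.PropositionalEquality using (_≡_)

open import Algebra.Bundles using (CommutativeMonoid)
open import Data.Product using (_,_)
open import Function using (_∘_)
open import Relation.Binary.PropositionalEquality using (refl; sym; trans; cong; _≗_; module ≡-Reasoning)

-- Let a₁ n r and a₁₁ n r count the words w ∈ [2]ⁿ for which 1w, resp. 11w, contains 112
-- exactly r times. Splitting off the first letter of a word gives
--   a(n+1,r) = a₁(n,r) + a(n,r),   a₁(n+1,r) = a₁₁(n,r) + a(n,r),   a₁₁(n+1,r) = a₁₁(n,r) + a(n,r-1),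
-- and eliminating a₁ and a₁₁ leaves a(n+3,r) - 2a(n+2,r) + a(n,r) = a(n,r-1). As
-- (1-x)(1-x-x²) = 1-2x+x³, this says that (1-x)(1-x-x²) times the generating function A_r
-- is x³A_{r-1} for r ≥ 1, and 1 for r = 0; the theorem follows by induction on r.

module Counting where

  open import Data.Nat using (zero; _+_; _≟_)
  open import Data.Nat.Properties using (+-suc; suc-injective)
  open import Data.Nat.Tactic.RingSolver using (solve-∀)
  open import Data.Fin using (zero; suc)
  open import Data.Vec using ([]; _∷_)
  open import Data.List using ([]; _∷_; length; filter; concatMap)
  open import Data.List.Properties using (filter-≐; filter-none)
  import Data.List.Relation.Unary.All as All
  open import Data.Bool using (true; false)
  open import Relation.Nullary using (does)
  open import Relation.Unary using (Pred; Decidable)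

  pattern one = zero
  pattern two = suc zero

  count : (n : ℕ) → (Word n → ℕ) → ℕ → ℕ
  count n f r = length (filter (λ w → f w ≟ r) (allWords n))

  length-filter-concatMap-pair : ∀ {a b p} {A : Set a} {B : Set b} {P : Pred B p}
    (P? : Decidable P) (x y : A → B) xs →
    length (filter P? (concatMap (λ w → x w ∷ y w ∷ []) xs))
      ≡ length (filter (P? ∘ x) xs) + length (filter (P? ∘ y) xs)
  length-filter-concatMap-pair P? x y [] = refl
  length-filter-concatMap-pair P? x y (w ∷ ws)
    with ih ← length-filter-concatMap-pair P? x y ws | does (P? (x w))
  ... | true with does (P? (y w))
  ...   | true  = cong suc (trans (cong suc ih) (sym (+-suc _ _)))
  ...   | false = cong suc ih
  length-filter-concatMap-pair P? x y (w ∷ ws) | false with does (P? (y w))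
  ...   | true  = trans (cong suc ih) (sym (+-suc _ _))
  ...   | false = ih

  count-suc : ∀ n (f : Word (suc n) → ℕ) r →
    count (suc n) f r ≡ count n (λ w → f (one ∷ w)) r + count n (λ w → f (two ∷ w)) r
  count-suc n f r = length-filter-concatMap-pair (λ w → f w ≟ r) (one ∷_) (two ∷_) (allWords n)

  count-cong : ∀ n {f g : Word n → ℕ} r → f ≗ g → count n f r ≡ count n g r
  count-cong n r f≗g = cong length
    (filter-≐ _ _ ((λ {w} → trans (sym (f≗g w))) , (λ {w} → trans (f≗g w))) (allWords n))

  count-suc∘-zero : ∀ n (f : Word n → ℕ) → count n (suc ∘ f) 0 ≡ 0
  count-suc∘-zero n f = cong length (filter-none (λ w → suc (f w) ≟ 0) {allWords n} (All.tabulate λ _ ()))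

  count-suc∘-suc : ∀ n (f : Word n → ℕ) r → count n (suc ∘ f) (suc r) ≡ count n f r
  count-suc∘-suc n f r = cong length (filter-≐ _ _ (suc-injective , cong suc) (allWords n))

  occ112-2∷ : ∀ {n} (w : Word n) → occ112 (two ∷ w) ≡ occ112 w
  occ112-2∷ []              = refl
  occ112-2∷ (_ ∷ [])        = refl
  occ112-2∷ (one ∷ _ ∷ _)   = refl
  occ112-2∷ (two ∷ one ∷ _) = refl
  occ112-2∷ (two ∷ two ∷ _) = refl

  occ112-12∷ : ∀ {n} (w : Word n) → occ112 (one ∷ two ∷ w) ≡ occ112 w
  occ112-12∷ []      = refl
  occ112-12∷ (x ∷ w) = occ112-2∷ (x ∷ w)

  occ112-112∷ : ∀ {n} (w : Word n) → occ112 (one ∷ one ∷ two ∷ w) ≡ suc (occ112 w)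
  occ112-112∷ w = cong suc (occ112-12∷ w)

  a₁ a₁₁ : ℕ → ℕ → ℕ
  a₁ n r = count n (λ w → occ112 (one ∷ w)) r
  a₁₁ n r = count n (λ w → occ112 (one ∷ one ∷ w)) r

  a-suc : ∀ n r → a (suc n) r ≡ a₁ n r + a n r
  a-suc n r = trans (count-suc n occ112 r) (cong (a₁ n r +_) (count-cong n r occ112-2∷))

  a₁-suc : ∀ n r → a₁ (suc n) r ≡ a₁₁ n r + a n r
  a₁-suc n r = trans (count-suc n _ r) (cong (a₁₁ n r +_) (count-cong n r occ112-12∷))

  a₁₁-suc : ∀ n r → a₁₁ (suc n) r ≡ a₁₁ n r + count n (suc ∘ occ112) r
  a₁₁-suc n r = trans (count-suc n _ r) (cong (a₁₁ n r +_) (count-cong n r occ112-112∷))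

  -- count n (suc ∘ occ112) r is a(n, r - 1), read as 0 when r = 0.
  a-recurrence : ∀ n r → a (3 + n) r + a n r ≡ 2 * a (2 + n) r + count n (suc ∘ occ112) r
  a-recurrence n r = begin
    a (3 + n) r + a n r
      ≡⟨ cong (_+ a n r) expand₃ ⟩
    (a₁₁ n r + d) + a (1 + n) r + a (2 + n) r + a n r
      ≡⟨ rearrange (a₁₁ n r) d (a (1 + n) r) (a (2 + n) r) (a n r) ⟩
    (a₁₁ n r + a n r) + a (1 + n) r + a (2 + n) r + d
      ≡⟨ cong (λ m → m + a (2 + n) r + d) expand₂ ⟨
    a (2 + n) r + a (2 + n) r + d
      ≡⟨ double (a (2 + n) r) d ⟩
    2 * a (2 + n) r + d ∎
    where
    open ≡-Reasoning
    d : ℕ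
    d = count n (suc ∘ occ112) r
    expand₂ : a (2 + n) r ≡ (a₁₁ n r + a n r) + a (1 + n) r
    expand₂ = trans (a-suc (1 + n) r) (cong (_+ a (1 + n) r) (a₁-suc n r))
    expand₃ : a (3 + n) r ≡ (a₁₁ n r + d) + a (1 + n) r + a (2 + n) r
    expand₃ = trans (a-suc (2 + n) r) (cong (_+ a (2 + n) r)
                (trans (a₁-suc (1 + n) r) (cong (_+ a (1 + n) r) (a₁₁-suc n r))))
    rearrange : ∀ c d x y z → (c + d) + x + y + z ≡ (c + z) + x + y + d
    rearrange = solve-∀
    double : ∀ x d → x + x + d ≡ 2 * x + d
    double = solve-∀

module PowerSeries where

  open import Data.Nat as ℕ using (zero; _∸_)
  open import Data.Integer using (ℤ; +0; 1ℤ; -1ℤ; -[1+_]; _+_) renaming (_*_ to _·_)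
  open import Data.Integer.Properties using (+-identityˡ; +-identityʳ; *-identityˡ; *-comm)
  open import Data.Integer.Tactic.RingSolver using (solve-∀)
  open import Data.List using (upTo)
  open import Data.List.Properties using (map-cong; map-applyUpTo)
  open import Function using (id)
  open import Relation.Binary.Bundles using (Setoid)
  open import Relation.Binary.PropositionalEquality using (cong₂; _→-setoid_)

  tail : FPS → FPS
  tail f n = f (suc n)

  zeroS : FPS
  zeroS _ = +0

  ⊛-suc : ∀ f g n → (f ⊛ g) (suc n) ≡ f 0 · g (suc n) + (tail f ⊛ g) n
  ⊛-suc f g n = cong (f 0 · g (suc n) +_) (cong sumℤ
    (trans (map-applyUpTo suc (λ k → f k · g (suc n ∸ k)) (suc n))
           (sym (map-applyUpTo id (λ k → f (suc k) · g (n ∸ k)) (suc n)))))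

  ⊛-cong : ∀ {f f′ g g′} → f ≗ f′ → g ≗ g′ → f ⊛ g ≗ f′ ⊛ g′
  ⊛-cong f≗f′ g≗g′ n =
    cong sumℤ (map-cong (λ k → cong₂ _·_ (f≗f′ k) (g≗g′ (n ∸ k))) (upTo (suc n)))

  ⊛-congˡ : ∀ f {g g′} → g ≗ g′ → f ⊛ g ≗ f ⊛ g′
  ⊛-congˡ f g≗g′ = ⊛-cong {f} {f} (λ _ → refl) g≗g′

  ⊛-congʳ : ∀ {f f′} g → f ≗ f′ → f ⊛ g ≗ f′ ⊛ g
  ⊛-congʳ g f≗f′ = ⊛-cong {g = g} {g} f≗f′ (λ _ → refl)

  ⊛-zeroˡ : ∀ g → zeroS ⊛ g ≗ zeroS
  ⊛-zeroˡ g zero    = refl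
  ⊛-zeroˡ g (suc n) = trans (⊛-suc zeroS g n) (cong (+0 · g (suc n) +_) (⊛-zeroˡ g n))

  ⊛-identityˡ : ∀ g → oneS ⊛ g ≗ g
  ⊛-identityˡ g zero    = trans (+-identityʳ _) (*-identityˡ (g 0))
  ⊛-identityˡ g (suc n) = begin
    (oneS ⊛ g) (suc n)              ≡⟨ ⊛-suc oneS g n ⟩
    1ℤ · g (suc n) + (zeroS ⊛ g) n  ≡⟨ cong (1ℤ · g (suc n) +_) (⊛-zeroˡ g n) ⟩
    1ℤ · g (suc n) + +0             ≡⟨ trans (+-identityʳ _) (*-identityˡ (g (suc n))) ⟩
    g (suc n)                       ∎
    where open ≡-Reasoning

  ⊛-linearˡ : ∀ c f f′ h → (λ k → c · f k + f′ k) ⊛ h ≗ (λ n → c · (f ⊛ h) n + (f′ ⊛ h) n)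
  ⊛-linearˡ c f f′ h zero = shuffle c (f 0) (f′ 0) (h 0)
    where
    shuffle : ∀ c x x′ y → (c · x + x′) · y + +0 ≡ c · (x · y + +0) + (x′ · y + +0)
    shuffle = solve-∀
  ⊛-linearˡ c f f′ h (suc n) = begin
    ((λ k → c · f k + f′ k) ⊛ h) (suc n)
      ≡⟨ ⊛-suc (λ k → c · f k + f′ k) h n ⟩
    (c · f 0 + f′ 0) · h (suc n) + ((λ k → c · tail f k + tail f′ k) ⊛ h) n
      ≡⟨ cong ((c · f 0 + f′ 0) · h (suc n) +_) (⊛-linearˡ c (tail f) (tail f′) h n) ⟩
    (c · f 0 + f′ 0) · h (suc n) + (c · (tail f ⊛ h) n + (tail f′ ⊛ h) n)
      ≡⟨ shuffle c (f 0) (f′ 0) (h (suc n)) ((tail f ⊛ h) n) ((tail f′ ⊛ h) n) ⟩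
    c · (f 0 · h (suc n) + (tail f ⊛ h) n) + (f′ 0 · h (suc n) + (tail f′ ⊛ h) n)
      ≡⟨ cong₂ (λ u v → c · u + v) (⊛-suc f h n) (⊛-suc f′ h n) ⟨
    c · (f ⊛ h) (suc n) + (f′ ⊛ h) (suc n) ∎
    where
    open ≡-Reasoning
    shuffle : ∀ c x x′ y u u′ → (c · x + x′) · y + (c · u + u′) ≡ c · (x · y + u) + (x′ · y + u′)
    shuffle = solve-∀

  ⊛-assoc : ∀ f g h → (f ⊛ g) ⊛ h ≗ f ⊛ (g ⊛ h)
  ⊛-assoc f g h zero = shuffle (f 0) (g 0) (h 0)
    where
    shuffle : ∀ x y z → (x · y + +0) · z + +0 ≡ x · (y · z + +0) + +0
    shuffle = solve-∀
  ⊛-assoc f g h (suc n) = begin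
    ((f ⊛ g) ⊛ h) (suc n)
      ≡⟨ ⊛-suc (f ⊛ g) h n ⟩
    (f ⊛ g) 0 · h (suc n) + (tail (f ⊛ g) ⊛ h) n
      ≡⟨ cong ((f ⊛ g) 0 · h (suc n) +_) (⊛-congʳ h (⊛-suc f g) n) ⟩
    (f ⊛ g) 0 · h (suc n) + ((λ k → f 0 · tail g k + (tail f ⊛ g) k) ⊛ h) n
      ≡⟨ cong ((f ⊛ g) 0 · h (suc n) +_) (⊛-linearˡ (f 0) (tail g) (tail f ⊛ g) h n) ⟩
    (f ⊛ g) 0 · h (suc n) + (f 0 · (tail g ⊛ h) n + ((tail f ⊛ g) ⊛ h) n)
      ≡⟨ cong (λ u → (f ⊛ g) 0 · h (suc n) + (f 0 · (tail g ⊛ h) n + u)) (⊛-assoc (tail f) g h n) ⟩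
    (f 0 · g 0 + +0) · h (suc n) + (f 0 · (tail g ⊛ h) n + (tail f ⊛ (g ⊛ h)) n)
      ≡⟨ shuffle (f 0) (g 0) (h (suc n)) ((tail g ⊛ h) n) ((tail f ⊛ (g ⊛ h)) n) ⟩
    f 0 · (g 0 · h (suc n) + (tail g ⊛ h) n) + (tail f ⊛ (g ⊛ h)) n
      ≡⟨ cong (λ u → f 0 · u + (tail f ⊛ (g ⊛ h)) n) (⊛-suc g h n) ⟨
    f 0 · (g ⊛ h) (suc n) + (tail f ⊛ (g ⊛ h)) n
      ≡⟨ ⊛-suc f (g ⊛ h) n ⟨
    (f ⊛ (g ⊛ h)) (suc n) ∎
    where
    open ≡-Reasoning
    shuffle : ∀ x y z u v → (x · y + +0) · z + (x · u + v) ≡ x · (y · z + u) + v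
    shuffle = solve-∀

  ⊛-sucʳ : ∀ f g n → (f ⊛ g) (suc n) ≡ f (suc n) · g 0 + (f ⊛ tail g) n
  ⊛-sucʳ f g zero = trans (⊛-suc f g 0) (swap (f 0 · g 1) (f 1 · g 0))
    where
    swap : ∀ u v → u + (v + +0) ≡ v + (u + +0)
    swap = solve-∀
  ⊛-sucʳ f g (suc n) = begin
    (f ⊛ g) (suc (suc n))
      ≡⟨ ⊛-suc f g (suc n) ⟩
    f 0 · g (suc (suc n)) + (tail f ⊛ g) (suc n)
      ≡⟨ cong (f 0 · g (suc (suc n)) +_) (⊛-sucʳ (tail f) g n) ⟩
    f 0 · g (suc (suc n)) + (f (suc (suc n)) · g 0 + (tail f ⊛ tail g) n)
      ≡⟨ swap (f 0 · g (suc (suc n))) (f (suc (suc n)) · g 0) _ ⟩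
    f (suc (suc n)) · g 0 + (f 0 · g (suc (suc n)) + (tail f ⊛ tail g) n)
      ≡⟨ cong (f (suc (suc n)) · g 0 +_) (⊛-suc f (tail g) n) ⟨
    f (suc (suc n)) · g 0 + (f ⊛ tail g) (suc n) ∎
    where
    open ≡-Reasoning
    swap : ∀ u v w → u + (v + w) ≡ v + (u + w)
    swap = solve-∀

  ⊛-comm : ∀ f g → f ⊛ g ≗ g ⊛ f
  ⊛-comm f g zero    = cong (_+ +0) (*-comm (f 0) (g 0))
  ⊛-comm f g (suc n) = begin
    (f ⊛ g) (suc n)                   ≡⟨ ⊛-suc f g n ⟩
    f 0 · g (suc n) + (tail f ⊛ g) n  ≡⟨ cong₂ _+_ (*-comm (f 0) (g (suc n))) (⊛-comm (tail f) g n) ⟩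
    g (suc n) · f 0 + (g ⊛ tail f) n  ≡⟨ ⊛-sucʳ g f n ⟨
    (g ⊛ f) (suc n)                   ∎
    where open ≡-Reasoning

  ⊛-commutativeMonoid : CommutativeMonoid _ _
  ⊛-commutativeMonoid = record
    { Carrier = FPS
    ; _≈_ = _≗_
    ; _∙_ = _⊛_
    ; ε = oneS
    ; isCommutativeMonoid = record
      { isMonoid = record
        { isSemigroup = record
          { isMagma = record
            { isEquivalence = Setoid.isEquivalence (ℕ →-setoid ℤ)
            ; ∙-cong = ⊛-cong
            }
          ; assoc = ⊛-assoc
          }
        ; identity = ⊛-identityˡ , λ f n → trans (⊛-comm f oneS n) (⊛-identityˡ f n)
        }
      ; comm = ⊛-comm
      }
    }

  open import Algebra.Properties.CommutativeMonoid.Mult ⊛-commutativeMonoid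
    using (_×_; ×-congʳ; ×-distrib-+; ×-homo-+)

  ^S≡× : ∀ f k → f ^S k ≡ k × f
  ^S≡× f zero    = refl
  ^S≡× f (suc k) = cong (f ⊛_) (^S≡× f k)

  ^S-congˡ : ∀ k {f g} → f ≗ g → f ^S k ≗ g ^S k
  ^S-congˡ k {f} {g} f≗g rewrite ^S≡× f k | ^S≡× g k = ×-congʳ k f≗g

  ^S-distrib-⊛ : ∀ f g k → (f ⊛ g) ^S k ≗ (f ^S k) ⊛ (g ^S k)
  ^S-distrib-⊛ f g k rewrite ^S≡× (f ⊛ g) k | ^S≡× f k | ^S≡× g k = ×-distrib-+ f g k

  ^S-homo-+ : ∀ f m k → f ^S (m ℕ.+ k) ≗ (f ^S m) ⊛ (f ^S k)
  ^S-homo-+ f m k rewrite ^S≡× f (m ℕ.+ k) | ^S≡× f m | ^S≡× f k = ×-homo-+ f m k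

  tail-X : tail X ≗ oneS
  tail-X zero    = refl
  tail-X (suc n) = refl

  X⊛-suc : ∀ f n → (X ⊛ f) (suc n) ≡ f n
  X⊛-suc f n = begin
    (X ⊛ f) (suc n)                  ≡⟨ ⊛-suc X f n ⟩
    +0 · f (suc n) + (tail X ⊛ f) n  ≡⟨ +-identityˡ _ ⟩
    (tail X ⊛ f) n                   ≡⟨ ⊛-congʳ f tail-X n ⟩
    (oneS ⊛ f) n                     ≡⟨ ⊛-identityˡ f n ⟩
    f n                              ∎
    where open ≡-Reasoning

  X^S⊛-shift : ∀ k f n → ((X ^S k) ⊛ f) (k ℕ.+ n) ≡ f n
  X^S⊛-shift zero    f n = ⊛-identityˡ f n
  X^S⊛-shift (suc k) f n = begin
    ((X ⊛ X ^S k) ⊛ f) (suc (k ℕ.+ n))  ≡⟨ ⊛-assoc X (X ^S k) f (suc (k ℕ.+ n)) ⟩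
    (X ⊛ (X ^S k ⊛ f)) (suc (k ℕ.+ n))  ≡⟨ X⊛-suc (X ^S k ⊛ f) (k ℕ.+ n) ⟩
    (X ^S k ⊛ f) (k ℕ.+ n)              ≡⟨ X^S⊛-shift k f n ⟩
    f n                                 ∎
    where open ≡-Reasoning

  oneMinus2XPlusX³ : FPS
  oneMinus2XPlusX³ 0 = 1ℤ
  oneMinus2XPlusX³ 1 = -[1+ 1 ]
  oneMinus2XPlusX³ 3 = 1ℤ
  oneMinus2XPlusX³ _ = +0

  oneMinusX⊛oneMinusXMinusX² : oneMinusX ⊛ oneMinusXMinusX² ≗ oneMinus2XPlusX³
  oneMinusX⊛oneMinusXMinusX² 0 = refl
  oneMinusX⊛oneMinusXMinusX² 1 = refl
  oneMinusX⊛oneMinusXMinusX² 2 = refl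
  oneMinusX⊛oneMinusXMinusX² 3 = refl
  oneMinusX⊛oneMinusXMinusX² (suc (suc (suc (suc n)))) = begin
    (oneMinusX ⊛ oneMinusXMinusX²) (4 ℕ.+ n)
      ≡⟨ ⊛-suc oneMinusX oneMinusXMinusX² (3 ℕ.+ n) ⟩
    1ℤ · +0 + (tail oneMinusX ⊛ oneMinusXMinusX²) (3 ℕ.+ n)
      ≡⟨ cong (1ℤ · +0 +_) (⊛-suc (tail oneMinusX) oneMinusXMinusX² (2 ℕ.+ n)) ⟩
    1ℤ · +0 + (-1ℤ · +0 + (zeroS ⊛ oneMinusXMinusX²) (2 ℕ.+ n))
      ≡⟨ cong (λ u → 1ℤ · +0 + (-1ℤ · +0 + u)) (⊛-zeroˡ oneMinusXMinusX² (2 ℕ.+ n)) ⟩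
    +0 ∎
    where open ≡-Reasoning

  oneMinus2XPlusX³⊛-coeff : ∀ g n →
    (oneMinus2XPlusX³ ⊛ g) (3 ℕ.+ n) ≡ g (3 ℕ.+ n) + -[1+ 1 ] · g (2 ℕ.+ n) + g n
  oneMinus2XPlusX³⊛-coeff g n = begin
    (oneMinus2XPlusX³ ⊛ g) (3 ℕ.+ n)
      ≡⟨ ⊛-suc oneMinus2XPlusX³ g (2 ℕ.+ n) ⟩
    1ℤ · g (3 ℕ.+ n) + (tail oneMinus2XPlusX³ ⊛ g) (2 ℕ.+ n)
      ≡⟨ cong (1ℤ · g (3 ℕ.+ n) +_) (⊛-suc (tail oneMinus2XPlusX³) g (1 ℕ.+ n)) ⟩
    1ℤ · g (3 ℕ.+ n) + (-[1+ 1 ] · g (2 ℕ.+ n) + (tail (tail oneMinus2XPlusX³) ⊛ g) (1 ℕ.+ n))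
      ≡⟨ cong (λ u → 1ℤ · g (3 ℕ.+ n) + (-[1+ 1 ] · g (2 ℕ.+ n) + u))
              (⊛-suc (tail (tail oneMinus2XPlusX³)) g n) ⟩
    1ℤ · g (3 ℕ.+ n) + (-[1+ 1 ] · g (2 ℕ.+ n) + (+0 · g (1 ℕ.+ n) + (tail³ ⊛ g) n))
      ≡⟨ cong (λ u → 1ℤ · g (3 ℕ.+ n) + (-[1+ 1 ] · g (2 ℕ.+ n) + (+0 · g (1 ℕ.+ n) + u)))
              (trans (⊛-congʳ g tail³≗oneS n) (⊛-identityˡ g n)) ⟩
    1ℤ · g (3 ℕ.+ n) + (-[1+ 1 ] · g (2 ℕ.+ n) + (+0 · g (1 ℕ.+ n) + g n))
      ≡⟨ normalise (g (3 ℕ.+ n)) (g (2 ℕ.+ n)) (g (1 ℕ.+ n)) (g n) ⟩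
    g (3 ℕ.+ n) + -[1+ 1 ] · g (2 ℕ.+ n) + g n ∎
    where
    open ≡-Reasoning
    tail³ : FPS
    tail³ = tail (tail (tail oneMinus2XPlusX³))
    tail³≗oneS : tail³ ≗ oneS
    tail³≗oneS zero    = refl
    tail³≗oneS (suc k) = refl
    normalise : ∀ x y z w → 1ℤ · x + (-[1+ 1 ] · y + (+0 · z + w)) ≡ x + -[1+ 1 ] · y + w
    normalise = solve-∀

module GeneratingFunction where

  open Counting using (count; count-suc∘-zero; count-suc∘-suc; a-recurrence)
  open PowerSeries
  open import Data.Nat as ℕ using (zero)
  open import Data.Integer using (+_; -[1+_]; _+_) renaming (_*_ to _·_)
  open import Data.Integer.Properties using (pos-+; pos-*)
  open import Data.Integer.Tactic.RingSolver using (solve-∀)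
  open CommutativeMonoid ⊛-commutativeMonoid using (setoid; assoc; comm; identityʳ)

  x+z≡2y+d⇒x-2y+z≡d : ∀ x y z d → x + z ≡ + 2 · y + d → x + -[1+ 1 ] · y + z ≡ d
  x+z≡2y+d⇒x-2y+z≡d x y z d eq = begin
    x + -[1+ 1 ] · y + z          ≡⟨ regroup x y z ⟩
    (x + z) + -[1+ 1 ] · y        ≡⟨ cong (λ u → u + -[1+ 1 ] · y) eq ⟩
    (+ 2 · y + d) + -[1+ 1 ] · y  ≡⟨ cancel y d ⟩
    d                             ∎
    where
    open ≡-Reasoning
    regroup : ∀ x y z → x + -[1+ 1 ] · y + z ≡ (x + z) + -[1+ 1 ] · y
    regroup = solve-∀
    cancel : ∀ y d → (+ 2 · y + d) + -[1+ 1 ] · y ≡ d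
    cancel = solve-∀

  oneMinus2XPlusX³⊛genFun-coeff : ∀ r n →
    (oneMinus2XPlusX³ ⊛ genFun r) (3 ℕ.+ n) ≡ + count n (suc ∘ occ112) r
  oneMinus2XPlusX³⊛genFun-coeff r n =
    trans (oneMinus2XPlusX³⊛-coeff (genFun r) n) (x+z≡2y+d⇒x-2y+z≡d
      (+ a (3 ℕ.+ n) r) (+ a (2 ℕ.+ n) r) (+ a n r) (+ count n (suc ∘ occ112) r) recurrenceℤ)
    where
    open ≡-Reasoning
    recurrenceℤ : + a (3 ℕ.+ n) r + + a n r ≡ + 2 · + a (2 ℕ.+ n) r + + count n (suc ∘ occ112) r
    recurrenceℤ = begin
      + a (3 ℕ.+ n) r + + a n r
        ≡⟨ pos-+ (a (3 ℕ.+ n) r) (a n r) ⟨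
      + (a (3 ℕ.+ n) r ℕ.+ a n r)
        ≡⟨ cong +_ (a-recurrence n r) ⟩
      + (2 * a (2 ℕ.+ n) r ℕ.+ count n (suc ∘ occ112) r)
        ≡⟨ pos-+ (2 * a (2 ℕ.+ n) r) (count n (suc ∘ occ112) r) ⟩
      + (2 * a (2 ℕ.+ n) r) + + count n (suc ∘ occ112) r
        ≡⟨ cong (λ u → u + + count n (suc ∘ occ112) r) (pos-* 2 (a (2 ℕ.+ n) r)) ⟩
      + 2 · + a (2 ℕ.+ n) r + + count n (suc ∘ occ112) r ∎

  oneMinus2XPlusX³⊛genFun-zero : oneMinus2XPlusX³ ⊛ genFun 0 ≗ oneS
  oneMinus2XPlusX³⊛genFun-zero 0 = refl
  oneMinus2XPlusX³⊛genFun-zero 1 = refl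
  oneMinus2XPlusX³⊛genFun-zero 2 = refl
  oneMinus2XPlusX³⊛genFun-zero (suc (suc (suc n))) =
    trans (oneMinus2XPlusX³⊛genFun-coeff 0 n) (cong +_ (count-suc∘-zero n occ112))

  oneMinus2XPlusX³⊛genFun-suc : ∀ r → oneMinus2XPlusX³ ⊛ genFun (suc r) ≗ (X ^S 3) ⊛ genFun r
  oneMinus2XPlusX³⊛genFun-suc r 0 = refl
  oneMinus2XPlusX³⊛genFun-suc r 1 = refl
  oneMinus2XPlusX³⊛genFun-suc r 2 = refl
  oneMinus2XPlusX³⊛genFun-suc r (suc (suc (suc n))) = begin
    (oneMinus2XPlusX³ ⊛ genFun (suc r)) (3 ℕ.+ n)  ≡⟨ oneMinus2XPlusX³⊛genFun-coeff (suc r) n ⟩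
    + count n (suc ∘ occ112) (suc r)               ≡⟨ cong +_ (count-suc∘-suc n occ112 r) ⟩
    genFun r n                                     ≡⟨ X^S⊛-shift 3 (genFun r) n ⟨
    ((X ^S 3) ⊛ genFun r) (3 ℕ.+ n)                ∎
    where open ≡-Reasoning

  genFun⊛oneMinus2XPlusX³^S-suc : ∀ r → genFun r ⊛ (oneMinus2XPlusX³ ^S suc r) ≗ X ^S (3 * r)
  genFun⊛oneMinus2XPlusX³^S-suc zero = begin
    genFun 0 ⊛ (P ⊛ oneS)  ≈⟨ ⊛-congˡ (genFun 0) (identityʳ P) ⟩
    genFun 0 ⊛ P           ≈⟨ comm (genFun 0) P ⟩
    P ⊛ genFun 0           ≈⟨ oneMinus2XPlusX³⊛genFun-zero ⟩
    oneS                   ∎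
    where
    open import Relation.Binary.Reasoning.Setoid setoid
    P : FPS
    P = oneMinus2XPlusX³
  genFun⊛oneMinus2XPlusX³^S-suc (suc r) = begin
    genFun (suc r) ⊛ (P ⊛ P ^S suc r)     ≈⟨ assoc (genFun (suc r)) P (P ^S suc r) ⟨
    (genFun (suc r) ⊛ P) ⊛ P ^S suc r     ≈⟨ ⊛-congʳ (P ^S suc r) (comm (genFun (suc r)) P) ⟩
    (P ⊛ genFun (suc r)) ⊛ P ^S suc r     ≈⟨ ⊛-congʳ (P ^S suc r) (oneMinus2XPlusX³⊛genFun-suc r) ⟩
    ((X ^S 3) ⊛ genFun r) ⊛ P ^S suc r    ≈⟨ assoc (X ^S 3) (genFun r) (P ^S suc r) ⟩
    (X ^S 3) ⊛ (genFun r ⊛ P ^S suc r)    ≈⟨ ⊛-congˡ (X ^S 3) (genFun⊛oneMinus2XPlusX³^S-suc r) ⟩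
    (X ^S 3) ⊛ (X ^S (3 * r))             ≈⟨ ^S-homo-+ X 3 (3 * r) ⟨
    X ^S (3 ℕ.+ 3 * r)                    ≡⟨ cong (X ^S_) (*-suc 3 r) ⟨
    X ^S (3 * suc r)                      ∎
    where
    open import Data.Nat.Properties using (*-suc)
    open import Relation.Binary.Reasoning.Setoid setoid
    P : FPS
    P = oneMinus2XPlusX³

open PowerSeries
  using (⊛-commutativeMonoid; ⊛-congˡ; ^S-congˡ; ^S-distrib-⊛; oneMinus2XPlusX³; oneMinusX⊛oneMinusXMinusX²)
open GeneratingFunction using (genFun⊛oneMinus2XPlusX³^S-suc)
open import Relation.Binary.Reasoning.Setoid (CommutativeMonoid.setoid ⊛-commutativeMonoid)

corollary2p4 : (r n : ℕ) →
    (genFun r ⊛ ((oneMinusX ^S suc r) ⊛ (oneMinusXMinusX² ^S suc r))) n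
      ≡ (X ^S (3 * r)) n
corollary2p4 r = begin
  genFun r ⊛ ((oneMinusX ^S suc r) ⊛ (oneMinusXMinusX² ^S suc r))
    ≈⟨ ⊛-congˡ (genFun r) (^S-distrib-⊛ oneMinusX oneMinusXMinusX² (suc r)) ⟨
  genFun r ⊛ ((oneMinusX ⊛ oneMinusXMinusX²) ^S suc r)
    ≈⟨ ⊛-congˡ (genFun r) (^S-congˡ (suc r) oneMinusX⊛oneMinusXMinusX²) ⟩
  genFun r ⊛ (oneMinus2XPlusX³ ^S suc r)
    ≈⟨ genFun⊛oneMinus2XPlusX³^S-suc r ⟩
  X ^S (3 * r) ∎
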